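{- Let $H$ be a directed graph on $n$ vertices whose underlying undirected graph has diameter $1$, let $(v_1,\dots,v_n)$ be an ordering of its vertices with $d_{out}(v_1)\le\dots\le d_{out}(v_n)$, and let $i\in\{1,\dots,n\}$. Then there exists an index $k\in\{i,\dots,n\}$ such that the set of vertices reachable from $v_i$ in $H$ equals $\{v_1,\dots,v_k\}$. Moreover, $k$ is the minimal index in $\{i,\dots,n\}$ for which $(n-k)k=\sum_{j=1}^k(d_{in}(v_j)-d_{out}(v_j))$.
   Context: Directed graphs are simple (no self-loops or multiple edges; anti-parallel edges allowed). $d_{in},d_{out}$ denote in- and out-degree. Underlying diameter $1$ means that between every two distinct vertices at least one directed edge is present. A vertex is reachable from $v_i$ if there is a directed path (possibly of length $0$) from $v_i$ to it. -}

module Defs where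

open import Data.Nat using (ℕ; zero; suc; _≤_; _<_; _+_)
open import Data.Bool using (Bool; true; false; if_then_else_)
open import Data.Fin using (Fin; toℕ)
open import Data.List using (List; map; filter)
open import Data.Nat.ListAction using (sum)
open import Data.Product using (_×_)
open import Data.Integer using (ℤ; +_; _-_; _*_)
open import Relation.Binary.PropositionalEquality using (_≡_)
open import Relation.Nullary using (¬_)
open import Relation.Binary.Construct.Closure.ReflexiveTransitive using (Star)
import Data.List as L

-- A simple digraph on vertex set Fin n, given by its adjacency relation
-- (edge u → v iff adj u v ≡ true).  Simplicity (no multi-edges) is built in;
-- no self-loops is imposed as a hypothesis.
Digraph : ℕ → Set
Digraph n = Fin n → Fin n → Bool

Loopless : ∀ {n} → Digraph n → Set
Loopless {n} H = (v : Fin n) → H v v ≡ false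

UnderlyingDiam1 : ∀ {n} → Digraph n → Set
UnderlyingDiam1 {n} H = (u v : Fin n) → ¬ (u ≡ v) → (H u v ≡ true) Data.Sum.⊎ (H v u ≡ true)
  where import Data.Sum

b2n : Bool → ℕ
b2n true = 1
b2n false = 0

dout : ∀ {n} → Digraph n → Fin n → ℕ
dout {n} H v = sum (map (λ w → b2n (H v w)) (L.allFin n))

din : ∀ {n} → Digraph n → Fin n → ℕ
din {n} H v = sum (map (λ w → b2n (H w v)) (L.allFin n))

Edge : ∀ {n} → Digraph n → Fin n → Fin n → Set
Edge H u v = H u v ≡ true

Reachable : ∀ {n} → Digraph n → Fin n → Fin n → Set
Reachable H = Star (Edge H)

-- Σ_{j=1}^{m} (din(v_j) - dout(v_j)) where v_j is vertex with toℕ = j-1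
-- (only the first m vertices of Fin n, i.e. those with toℕ v < m)
degDiffPrefix : ∀ {n} → Digraph n → ℕ → ℤ
degDiffPrefix {n} H m =
  L.foldr Data.Integer._+_ (+ 0)
    (L.map (λ v → (+ din H v) - (+ dout H v))
      (L.filter (λ v → toℕ v Data.Nat.<? m) (L.allFin n)))
  where import Data.Nat

-- the equation (n - k) k = Σ_{j=1}^k (din v_j - dout v_j), with k a 1-based index
BalanceEq : ∀ {n} → Digraph n → ℕ → Set
BalanceEq {n} H k = (+ n - + k) * (+ k) ≡ degDiffPrefix H k

-- Call the
-- prefix of the first m vertices closed if no edge leaves it.  The proof rests
-- on three facts.
--  (1) Descent: a vertex w reaches every vertex v of out-degree at most dout w,
--      within two steps.  If neither v = w nor w → v, diameter 1 gives v → w;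
--      counting out-degrees then yields an out-neighbour x of w with v ↛ x, so
--      x → v.  Hence reachable sets are closed downwards in the vertex order.
--  (2) Balance: for m ≤ n, writing P for the first m vertices and Q for the rest,
--      Σ_{v∈P} (din v - dout v) = e(Q,P) - e(P,Q) since edges inside P cancel.
--      As e(Q,P) ≤ |Q||P| = (n-m)m, the balance equation holds iff e(P,Q) = 0
--      (and then e(Q,P) = (n-m)m by diameter 1), i.e. iff the prefix is closed.
--  (3) Let k be the least m > i with a closed prefix (m = n always qualifies).
--      Paths from v_i never leave the closed prefix k; conversely every prefix
--      m with i < m < k is left by an edge, which by induction starts at a
--      reachable vertex, so by (1) all of the first k vertices are reachable.
-- By (2), k is also the least index above i satisfying the balance equation.
module Submission where

open import Defs
open import Data.Nat using (ℕ; zero; suc; _+_; _*_; _∸_; _≤_; _<_; _≤?_; _<?_; z≤n; s≤s; s≤s⁻¹)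
import Data.Nat.Properties as ℕ
open import Data.Nat.ListAction using (sum)
open import Algebra.Properties.CommutativeSemigroup ℕ.+-commutativeSemigroup
  using (interchange; x∙yz≈y∙xz)
open import Data.Integer using (+_; _⊖_) renaming (_+_ to _+ℤ_; _-_ to _-ℤ_; _*_ to _*ℤ_)
import Data.Integer.Properties as ℤ
open import Data.Integer.Tactic.RingSolver using (solve-∀)
open import Data.Bool using (true; false)
import Data.Bool.Properties as Bool
open import Data.Fin using (Fin; toℕ) renaming (suc to fsuc)
import Data.Fin.Properties as Fin
open import Data.List using (List; []; _∷_; map; filter; length; allFin; tabulate; foldr)
import Data.List.Properties as List
open import Data.List.Membership.Propositional using (_∈_)
open import Data.List.Membership.Propositional.Properties using (∈-allFin; ∈-filter⁺; ∈-filter⁻)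
open import Data.List.Relation.Unary.Any using (here; there)
open import Data.Product using (Σ; ∃; _×_; _,_; proj₂)
open import Data.Sum using (inj₁; inj₂)
open import Data.Empty using (⊥; ⊥-elim)
open import Function using (id; _∘_)
open import Function.Bundles using (_⇔_; mk⇔)
open import Level using (Level)
open import Relation.Binary.PropositionalEquality
open import Relation.Binary.Construct.Closure.ReflexiveTransitive using (ε; _◅_; _◅◅_)
open import Relation.Nullary using (¬_; Dec; yes; no; does)
open import Relation.Nullary.Decidable using (¬?; _×-dec_; decidable-stable)
open import Relation.Unary using (Pred; Decidable)
open import Relation.Unary.Properties using (∁?)

∑ : {X : Set} → List X → (X → ℕ) → ℕ
∑ xs f = sum (map f xs)

module _ {X : Set} where

  ∑-cong : ∀ (xs : List X) {f g : X → ℕ} → (∀ x → x ∈ xs → f x ≡ g x) → ∑ xs f ≡ ∑ xs g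
  ∑-cong []       f≗g = refl
  ∑-cong (x ∷ xs) f≗g = cong₂ _+_ (f≗g x (here refl)) (∑-cong xs λ y y∈xs → f≗g y (there y∈xs))

  ∑-mono : ∀ (xs : List X) {f g : X → ℕ} → (∀ x → x ∈ xs → f x ≤ g x) → ∑ xs f ≤ ∑ xs g
  ∑-mono []       f≤g = ℕ.≤-refl
  ∑-mono (x ∷ xs) f≤g = ℕ.+-mono-≤ (f≤g x (here refl)) (∑-mono xs λ y y∈xs → f≤g y (there y∈xs))

  ∑-mono-< : ∀ (xs : List X) {f g : X → ℕ} → (∀ x → x ∈ xs → f x ≤ g x) →
             ∀ {y} → y ∈ xs → f y < g y → ∑ xs f < ∑ xs g
  ∑-mono-< (x ∷ xs) f≤g (here refl) fy<gy =
    ℕ.+-mono-<-≤ fy<gy (∑-mono xs λ y y∈xs → f≤g y (there y∈xs))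
  ∑-mono-< (x ∷ xs) f≤g (there y∈xs) fy<gy =
    ℕ.+-mono-≤-< (f≤g x (here refl)) (∑-mono-< xs (λ z z∈xs → f≤g z (there z∈xs)) y∈xs fy<gy)

  ∑-+ : ∀ (xs : List X) (f g : X → ℕ) → ∑ xs (λ x → f x + g x) ≡ ∑ xs f + ∑ xs g
  ∑-+ []       f g = refl
  ∑-+ (x ∷ xs) f g =
    trans (cong (_+_ (f x + g x)) (∑-+ xs f g)) (interchange (f x) (g x) (∑ xs f) (∑ xs g))

  ∑-const : ∀ (xs : List X) c → ∑ xs (λ _ → c) ≡ length xs * c
  ∑-const []       c = refl
  ∑-const (x ∷ xs) c = cong (_+_ c) (∑-const xs c)

  ∑-zero : ∀ (xs : List X) {f : X → ℕ} → (∀ x → x ∈ xs → f x ≡ 0) → ∑ xs f ≡ 0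
  ∑-zero xs {f} f≡0 = trans (∑-cong xs f≡0) (trans (∑-const xs 0) (ℕ.*-zeroʳ (length xs)))

  ∑≡0 : ∀ (xs : List X) {f : X → ℕ} → ∑ xs f ≡ 0 → ∀ {x} → x ∈ xs → f x ≡ 0
  ∑≡0 (y ∷ xs) {f} sum≡0 (here refl)  = ℕ.m+n≡0⇒m≡0 (f y) sum≡0
  ∑≡0 (y ∷ xs) {f} sum≡0 (there x∈xs) = ∑≡0 xs (ℕ.m+n≡0⇒n≡0 (f y) sum≡0) x∈xs

  module _ {ℓ : Level} {P : Pred X ℓ} (P? : Decidable P) where

    length-partition : ∀ (xs : List X) → length xs ≡ length (filter P? xs) + length (filter (∁? P?) xs)
    length-partition []       = refl
    length-partition (x ∷ xs) with P? x
    ... | yes _ = cong suc (length-partition xs)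
    ... | no  _ = trans (cong suc (length-partition xs)) (sym (ℕ.+-suc _ _))

    ∑-partition : ∀ (xs : List X) (f : X → ℕ) →
                  ∑ xs f ≡ ∑ (filter P? xs) f + ∑ (filter (∁? P?) xs) f
    ∑-partition []       f = refl
    ∑-partition (x ∷ xs) f with P? x
    ... | yes _ = trans (cong (_+_ (f x)) (∑-partition xs f)) (sym (ℕ.+-assoc (f x) _ _))
    ... | no  _ = trans (cong (_+_ (f x)) (∑-partition xs f))
                        (x∙yz≈y∙xz (f x) (∑ (filter P? xs) f) (∑ (filter (∁? P?) xs) f))

∑-swap : ∀ {X Y : Set} (xs : List X) (ys : List Y) (h : X → Y → ℕ) →
         ∑ xs (λ x → ∑ ys (h x)) ≡ ∑ ys (λ y → ∑ xs (λ x → h x y))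
∑-swap []       ys h = sym (∑-zero ys (λ _ _ → refl))
∑-swap (x ∷ xs) ys h =
  trans (cong (_+_ (∑ ys (h x))) (∑-swap xs ys h)) (sym (∑-+ ys (h x) _))

∑∑-one : ∀ {A B : Set} (X : List A) (Y : List B) → ∑ X (λ _ → ∑ Y (λ _ → 1)) ≡ length X * length Y
∑∑-one X Y = begin
  ∑ X (λ _ → ∑ Y (λ _ → 1)) ≡⟨ ∑-cong X (λ _ _ → ∑-const Y 1) ⟩
  ∑ X (λ _ → length Y * 1)  ≡⟨ ∑-const X (length Y * 1) ⟩
  length X * (length Y * 1) ≡⟨ cong (length X *_) (ℕ.*-identityʳ (length Y)) ⟩
  length X * length Y       ∎
  where open ≡-Reasoning

length-filter-map : ∀ {A B : Set} {ℓ} {P : Pred B ℓ} (P? : Decidable P) (f : A → B) (xs : List A) →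
                    length (filter P? (map f xs)) ≡ length (filter (P? ∘ f) xs)
length-filter-map P? f []       = refl
length-filter-map P? f (x ∷ xs) with does (P? (f x))
... | true  = cong suc (length-filter-map P? f xs)
... | false = length-filter-map P? f xs

bool-conflict : ∀ {b} → b ≡ true → b ≡ false → ⊥
bool-conflict refl ()

b2n-mono : ∀ {a b} → (a ≡ true → b ≡ true) → b2n a ≤ b2n b
b2n-mono {false} a⇒b = z≤n
b2n-mono {true}  a⇒b rewrite a⇒b refl = ℕ.≤-refl

b2n≤1 : ∀ b → b2n b ≤ 1
b2n≤1 false = z≤n
b2n≤1 true  = ℕ.≤-refl

b2n-< : ∀ {a b} → a ≡ false → b ≡ true → b2n a < b2n b
b2n-< refl refl = ℕ.≤-refl

record LeastFrom (P : ℕ → Set) (a : ℕ) : Set where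
  field
    value : ℕ
    above : a ≤ value
    holds : P value
    least : ∀ m → a ≤ m → m < value → ¬ P m

  below-witness : ∀ {b} → a ≤ b → P b → value ≤ b
  below-witness a≤b Pb = ℕ.≮⇒≥ λ b<value → least _ a≤b b<value Pb

least-from : {P : ℕ → Set} → (∀ m → Dec (P m)) → ∀ {a b} → a ≤ b → P b → LeastFrom P a
least-from {P} P? {a} {b} a≤b Pb = search a (b ∸ a) (subst P (sym (ℕ.m∸n+n≡m a≤b)) Pb)
  where
  found : ∀ {a} → P a → LeastFrom P a
  found {a} Pa = record { value = a ; above = ℕ.≤-refl ; holds = Pa
                        ; least = λ m a≤m m<a → ⊥-elim (ℕ.<⇒≱ m<a a≤m) }
  search : ∀ a d → P (d + a) → LeastFrom P a
  search a zero    Pa     = found Pa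
  search a (suc d) Pd+1+a with P? a
  ... | yes Pa = found Pa
  ... | no ¬Pa = record { value = value ; above = ℕ.<⇒≤ above ; holds = holds ; least = least′ }
    where
    open LeastFrom (search (suc a) d (subst P (sym (ℕ.+-suc d a)) Pd+1+a))
    least′ : ∀ m → a ≤ m → m < value → ¬ P m
    least′ m a≤m m<value with ℕ.m≤n⇒m<n∨m≡n a≤m
    ... | inj₁ a<m  = least m a<m m<value
    ... | inj₂ refl = ¬Pa

foldr-difference : ∀ {A : Set} (xs : List A) (f g : A → ℕ) →
  foldr _+ℤ_ (+ 0) (map (λ x → + f x -ℤ + g x) xs) ≡ + ∑ xs f -ℤ + ∑ xs g
foldr-difference []       f g = refl
foldr-difference (x ∷ xs) f g = begin
  (+ f x -ℤ + g x) +ℤ foldr _+ℤ_ (+ 0) (map (λ x → + f x -ℤ + g x) xs)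
    ≡⟨ cong ((+ f x -ℤ + g x) +ℤ_) (foldr-difference xs f g) ⟩
  (+ f x -ℤ + g x) +ℤ (+ ∑ xs f -ℤ + ∑ xs g)
    ≡⟨ regroup (+ f x) (+ g x) (+ ∑ xs f) (+ ∑ xs g) ⟩
  (+ f x +ℤ + ∑ xs f) -ℤ (+ g x +ℤ + ∑ xs g)
    ≡⟨ sym (cong₂ _-ℤ_ (ℤ.pos-+ (f x) (∑ xs f)) (ℤ.pos-+ (g x) (∑ xs g))) ⟩
  + (f x + ∑ xs f) -ℤ + (g x + ∑ xs g) ∎
  where
  open ≡-Reasoning
  regroup : ∀ a b c d → (a -ℤ b) +ℤ (c -ℤ d) ≡ (a +ℤ c) -ℤ (b +ℤ d)
  regroup = solve-∀

cancel-common : ∀ a b c → + (a + b) -ℤ + (a + c) ≡ + b -ℤ + c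
cancel-common a b c = begin
  + (a + b) -ℤ + (a + c)          ≡⟨ cong₂ _-ℤ_ (ℤ.pos-+ a b) (ℤ.pos-+ a c) ⟩
  (+ a +ℤ + b) -ℤ (+ a +ℤ + c)    ≡⟨ cancel (+ a) (+ b) (+ c) ⟩
  + b -ℤ + c                      ∎
  where
  open ≡-Reasoning
  cancel : ∀ x y z → (x +ℤ y) -ℤ (x +ℤ z) ≡ y -ℤ z
  cancel = solve-∀

difference-bound : ∀ N x y → + N ≡ + x -ℤ + y → x ≤ N → y ≡ 0
difference-bound N x y N≡x-y x≤N = ℕ.n≤0⇒n≡0 (ℕ.+-cancelˡ-≤ N y 0 N+y≤N+0)
  where
  N+y≡x : N + y ≡ x
  N+y≡x = ℤ.+-injective (begin
    + (N + y)                 ≡⟨ ℤ.pos-+ N y ⟩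
    + N +ℤ + y                ≡⟨ cong (_+ℤ + y) N≡x-y ⟩
    (+ x -ℤ + y) +ℤ + y       ≡⟨ minus-plus (+ x) (+ y) ⟩
    + x                       ∎)
    where
    open ≡-Reasoning
    minus-plus : ∀ a b → (a -ℤ b) +ℤ b ≡ a
    minus-plus = solve-∀
  N+y≤N+0 : N + y ≤ N + 0
  N+y≤N+0 = subst₂ _≤_ (sym N+y≡x) (sym (ℕ.+-identityʳ N)) x≤N

balance-lhs : ∀ {n m} → m ≤ n → (+ n -ℤ + m) *ℤ + m ≡ + ((n ∸ m) * m)
balance-lhs {n} {m} m≤n = begin
  (+ n -ℤ + m) *ℤ + m    ≡⟨ cong (_*ℤ + m) (ℤ.m-n≡m⊖n n m) ⟩
  (n ⊖ m) *ℤ + m         ≡⟨ cong (_*ℤ + m) (ℤ.⊖-≥ m≤n) ⟩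
  + (n ∸ m) *ℤ + m       ≡⟨ sym (ℤ.pos-* (n ∸ m) m) ⟩
  + ((n ∸ m) * m)        ∎
  where open ≡-Reasoning

module _ {n : ℕ} (H : Digraph n) where

  dout-< : ∀ {v w} x → (∀ y → Edge H v y → Edge H w y) → H v x ≡ false → Edge H w x →
           dout H v < dout H w
  dout-< x v⊆w vx wx =
    ∑-mono-< (allFin n) (λ y _ → b2n-mono (v⊆w y)) (∈-allFin x) (b2n-< vx wx)

  -- If v → w, w has no loop and dout v ≤ dout w, then w has an out-neighbour
  -- that v does not have (otherwise w itself would make v's out-degree larger).
  private-neighbour : ∀ {v w} → H w w ≡ false → Edge H v w → dout H v ≤ dout H w →
                      ∃ λ x → Edge H w x × H v x ≡ false
  private-neighbour {v} {w} ww vw dv≤dw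
    with Fin.any? (λ x → (H w x Bool.≟ true) ×-dec (H v x Bool.≟ false))
  ... | yes found = found
  ... | no  none  = ⊥-elim (ℕ.<⇒≱ (dout-< w w⊆v ww vw) dv≤dw)
    where
    w⊆v : ∀ y → Edge H w y → Edge H v y
    w⊆v y wy with H v y in vy
    ... | true  = refl
    ... | false = ⊥-elim (none (y , wy , vy))

  reverse-edge : UnderlyingDiam1 H → ∀ {u v} → ¬ u ≡ v → H v u ≡ false → Edge H u v
  reverse-edge diam {u} {v} u≢v vu with diam u v u≢v
  ... | inj₁ uv = uv
  ... | inj₂ vu′ = ⊥-elim (bool-conflict vu′ vu)

  descend : Loopless H → UnderlyingDiam1 H → ∀ {v w} → dout H v ≤ dout H w → Reachable H w v
  descend loopless diam {v} {w} dv≤dw with v Fin.≟ w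
  ... | yes refl = ε
  ... | no  v≢w with H w v in wv
  ...   | true  = wv ◅ ε
  ...   | false with private-neighbour (loopless w) (reverse-edge diam v≢w wv) dv≤dw
  ...     | x , wx , vx = wx ◅ reverse-edge diam x≢v vx ◅ ε
    where
    x≢v : ¬ x ≡ v
    x≢v refl = bool-conflict wx wv

  Crossing : ℕ → Set
  Crossing m = ∃ λ u → ∃ λ w → toℕ u < m × m ≤ toℕ w × Edge H u w

  Closed : ℕ → Set
  Closed m = ¬ Crossing m

  crossing? : ∀ m → Dec (Crossing m)
  crossing? m = Fin.any? λ u → Fin.any? λ w →
    (toℕ u <? m) ×-dec (m ≤? toℕ w) ×-dec (H u w Bool.≟ true)

  closed? : ∀ m → Dec (Closed m)
  closed? m = ¬? (crossing? m)

  closed-whole : Closed n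
  closed-whole (_ , w , _ , n≤w , _) = ℕ.<⇒≱ (Fin.toℕ<n w) n≤w

  closed⇒no-edge : ∀ {m u w} → Closed m → toℕ u < m → m ≤ toℕ w → H u w ≡ false
  closed⇒no-edge {m} {u} {w} closed u<m m≤w with H u w in uw
  ... | true  = ⊥-elim (closed (u , w , u<m , m≤w , uw))
  ... | false = refl

  closed-trap : ∀ {k u v} → Closed k → Reachable H u v → toℕ u < k → toℕ v < k
  closed-trap closed ε           u<k = u<k
  closed-trap {k} closed (_◅_ {j = x} ux x⇝v) u<k with toℕ x <? k
  ... | yes x<k = closed-trap closed x⇝v x<k
  ... | no  x≮k = ⊥-elim (closed (_ , x , u<k , ℕ.≮⇒≥ x≮k , ux))

count-below : ∀ {n} m → m ≤ n → length (filter (λ v → toℕ v <? m) (allFin n)) ≡ m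
count-below {n} zero _ = none-below (allFin n)
  where
  none-below : (xs : List (Fin n)) → length (filter (λ v → toℕ v <? 0) xs) ≡ 0
  none-below []       = refl
  none-below (x ∷ xs) = none-below xs
count-below {suc n} (suc m) (s≤s m≤n) = cong suc (begin
  length (filter (λ v → toℕ v <? suc m) (tabulate {n = n} fsuc))
    ≡⟨ cong (length ∘ filter (λ v → toℕ v <? suc m)) (sym (List.map-tabulate {n = n} id fsuc)) ⟩
  length (filter (λ v → toℕ v <? suc m) (map fsuc (allFin n)))
    ≡⟨ length-filter-map (λ v → toℕ v <? suc m) fsuc (allFin n) ⟩
  length (filter (λ v → suc (toℕ v) <? suc m) (allFin n))
    ≡⟨ cong length (List.filter-≐ _ (λ v → toℕ v <? m) (s≤s⁻¹ , s≤s) (allFin n)) ⟩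
  length (filter (λ v → toℕ v <? m) (allFin n))
    ≡⟨ count-below m m≤n ⟩
  m ∎)
  where open ≡-Reasoning

edges : ∀ {n} → Digraph n → List (Fin n) → List (Fin n) → ℕ
edges H X Y = ∑ X λ x → ∑ Y λ y → b2n (H x y)

module Prefix {n : ℕ} (H : Digraph n) (m : ℕ) where

  inside? : (v : Fin n) → Dec (toℕ v < m)
  inside? v = toℕ v <? m

  P Q : List (Fin n)
  P = filter inside? (allFin n)
  Q = filter (∁? inside?) (allFin n)

  ∈P : ∀ {v} → toℕ v < m → v ∈ P
  ∈P v<m = ∈-filter⁺ inside? (∈-allFin _) v<m

  ∈Q : ∀ {v} → ¬ toℕ v < m → v ∈ Q
  ∈Q v≮m = ∈-filter⁺ (∁? inside?) (∈-allFin _) v≮m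

  P∋ : ∀ {v} → v ∈ P → toℕ v < m
  P∋ v∈P = proj₂ (∈-filter⁻ inside? {xs = allFin n} v∈P)

  Q∌ : ∀ {v} → v ∈ Q → ¬ toℕ v < m
  Q∌ v∈Q = proj₂ (∈-filter⁻ (∁? inside?) {xs = allFin n} v∈Q)

  |P| : m ≤ n → length P ≡ m
  |P| = count-below m

  |Q| : m ≤ n → length Q ≡ n ∸ m
  |Q| m≤n = begin
    length Q                       ≡⟨ sym (ℕ.m+n∸m≡n (length P) (length Q)) ⟩
    length P + length Q ∸ length P ≡⟨ cong₂ _∸_ (sym (length-partition inside? (allFin n))) (|P| m≤n) ⟩
    length (allFin n) ∸ m          ≡⟨ cong (_∸ m) (List.length-tabulate id) ⟩
    n ∸ m                          ∎
    where open ≡-Reasoning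

  out-degrees : ∑ P (dout H) ≡ edges H P P + edges H P Q
  out-degrees = begin
    ∑ P (dout H)
      ≡⟨ ∑-cong P (λ v _ → ∑-partition inside? (allFin n) (λ w → b2n (H v w))) ⟩
    ∑ P (λ v → ∑ P (λ w → b2n (H v w)) + ∑ Q (λ w → b2n (H v w)))
      ≡⟨ ∑-+ P _ _ ⟩
    edges H P P + edges H P Q ∎
    where open ≡-Reasoning

  in-degrees : ∑ P (din H) ≡ edges H P P + edges H Q P
  in-degrees = begin
    ∑ P (din H)              ≡⟨ ∑-swap P (allFin n) (λ v w → b2n (H w v)) ⟩
    edges H (allFin n) P     ≡⟨ ∑-partition inside? (allFin n) (λ w → ∑ P (λ v → b2n (H w v))) ⟩
    edges H P P + edges H Q P ∎
    where open ≡-Reasoning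

  -- Edges inside P cancel: the degree imbalance of P is backward minus forward edges.
  degree-imbalance : degDiffPrefix H m ≡ + edges H Q P -ℤ + edges H P Q
  degree-imbalance = begin
    degDiffPrefix H m                   ≡⟨ foldr-difference P (din H) (dout H) ⟩
    + ∑ P (din H) -ℤ + ∑ P (dout H)     ≡⟨ cong₂ (λ a b → + a -ℤ + b) in-degrees out-degrees ⟩
    + (edges H P P + edges H Q P) -ℤ + (edges H P P + edges H P Q)
                                        ≡⟨ cancel-common (edges H P P) _ _ ⟩
    + edges H Q P -ℤ + edges H P Q      ∎
    where open ≡-Reasoning

  -- At most one backward edge per pair (w, v) ∈ Q × P.
  backward-≤ : m ≤ n → edges H Q P ≤ (n ∸ m) * m
  backward-≤ m≤n = begin
    edges H Q P                   ≤⟨ ∑-mono Q (λ w _ → ∑-mono P (λ v _ → b2n≤1 (H w v))) ⟩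
    ∑ Q (λ _ → ∑ P (λ _ → 1))     ≡⟨ ∑∑-one Q P ⟩
    length Q * length P           ≡⟨ cong₂ _*_ (|Q| m≤n) (|P| m≤n) ⟩
    (n ∸ m) * m                   ∎
    where open ℕ.≤-Reasoning

  closed⇒no-forward : Closed H m → edges H P Q ≡ 0
  closed⇒no-forward closed = ∑-zero P λ u u∈P → ∑-zero Q λ w w∈Q →
    cong b2n (closed⇒no-edge H closed (P∋ u∈P) (ℕ.≮⇒≥ (Q∌ w∈Q)))

  no-forward⇒closed : edges H P Q ≡ 0 → Closed H m
  no-forward⇒closed none (u , w , u<m , m≤w , uw) =
    ℕ.1+n≢0 (trans (sym (cong b2n uw)) (∑≡0 Q (∑≡0 P none (∈P u<m)) (∈Q (ℕ.≤⇒≯ m≤w))))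

  -- With underlying diameter 1, a closed prefix receives an edge from every later vertex.
  closed⇒all-backward : UnderlyingDiam1 H → m ≤ n → Closed H m → edges H Q P ≡ (n ∸ m) * m
  closed⇒all-backward diam m≤n closed = begin
    edges H Q P                ≡⟨ ∑-cong Q (λ w w∈Q → ∑-cong P (λ v v∈P → cong b2n (back w∈Q v∈P))) ⟩
    ∑ Q (λ _ → ∑ P (λ _ → 1))  ≡⟨ ∑∑-one Q P ⟩
    length Q * length P        ≡⟨ cong₂ _*_ (|Q| m≤n) (|P| m≤n) ⟩
    (n ∸ m) * m                ∎
    where
    open ≡-Reasoning
    back : ∀ {w v} → w ∈ Q → v ∈ P → Edge H w v
    back w∈Q v∈P = reverse-edge H diam (λ { refl → Q∌ w∈Q (P∋ v∈P) })
                     (closed⇒no-edge H closed (P∋ v∈P) (ℕ.≮⇒≥ (Q∌ w∈Q)))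

module _ {n : ℕ} (H : Digraph n) {m : ℕ} (m≤n : m ≤ n) where
  open Prefix H m

  closed⇒balanced : UnderlyingDiam1 H → Closed H m → BalanceEq H m
  closed⇒balanced diam closed = begin
    (+ n -ℤ + m) *ℤ + m             ≡⟨ balance-lhs m≤n ⟩
    + ((n ∸ m) * m)                 ≡⟨ cong +_ (sym (closed⇒all-backward diam m≤n closed)) ⟩
    + edges H Q P                   ≡⟨ sym (ℤ.+-identityʳ (+ edges H Q P)) ⟩
    + edges H Q P -ℤ + 0            ≡⟨ cong (λ e → + edges H Q P -ℤ + e) (sym (closed⇒no-forward closed)) ⟩
    + edges H Q P -ℤ + edges H P Q  ≡⟨ sym degree-imbalance ⟩
    degDiffPrefix H m               ∎
    where open ≡-Reasoning

  balanced⇒closed : BalanceEq H m → Closed H m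
  balanced⇒closed balanced = no-forward⇒closed
    (difference-bound ((n ∸ m) * m) (edges H Q P) (edges H P Q) pairs≡imbalance (backward-≤ m≤n))
    where
    pairs≡imbalance : + ((n ∸ m) * m) ≡ + edges H Q P -ℤ + edges H P Q
    pairs≡imbalance = trans (sym (balance-lhs m≤n)) (trans balanced degree-imbalance)

module _ {n : ℕ} (H : Digraph n) (loopless : Loopless H) (diam : UnderlyingDiam1 H)
         (sorted : (u v : Fin n) → toℕ u ≤ toℕ v → dout H u ≤ dout H v) where

  reach-down : ∀ {i w v} → Reachable H i w → toℕ v ≤ toℕ w → Reachable H i v
  reach-down i⇝w v≤w = i⇝w ◅◅ descend H loopless diam (sorted _ _ v≤w)

  -- If no prefix of length between toℕ i + 1 and k is closed, the first k vertices are
  -- reachable from i: each non-closed prefix is left by an edge from a reachable vertex.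
  reach-below : (i : Fin n) (k : ℕ) → (∀ m → toℕ i < m → m < k → ¬ Closed H m) →
                ∀ v → toℕ v < k → Reachable H i v
  reach-below i zero    unclosed v ()
  reach-below i (suc k) unclosed v v<1+k with toℕ v ≤? toℕ i
  ... | yes v≤i = reach-down ε v≤i
  ... | no  v≰i with decidable-stable (crossing? H k)
                       (unclosed k (ℕ.<-≤-trans (ℕ.≰⇒> v≰i) (ℕ.≤-pred v<1+k)) ℕ.≤-refl)
  ...   | u , w , u<k , k≤w , uw =
    reach-down (reach-below i k unclosed′ u u<k ◅◅ uw ◅ ε) (ℕ.≤-trans (ℕ.≤-pred v<1+k) k≤w)
    where
    unclosed′ : ∀ m → toℕ i < m → m < k → ¬ Closed H m
    unclosed′ m i<m m<k = unclosed m i<m (ℕ.m<n⇒m<1+n m<k)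

lemma2 : (n : ℕ) (H : Digraph n) → Loopless H → UnderlyingDiam1 H →
    ((u v : Fin n) → toℕ u ≤ toℕ v → dout H u ≤ dout H v) →
    (i : Fin n) →
    Σ ℕ (λ k → (suc (toℕ i) ≤ k × k ≤ n)
    × ((v : Fin n) → Reachable H i v ⇔ toℕ v < k)
    × BalanceEq H k
    × ((m : ℕ) → suc (toℕ i) ≤ m → m < k → ¬ BalanceEq H m))
lemma2 n H loopless diam sorted i =
  k , (above , k≤n) , reachable⇔below , closed⇒balanced H k≤n diam holds , minimal
  where
  open LeastFrom (least-from (closed? H) (Fin.toℕ<n i) (closed-whole H)) renaming (value to k)
  k≤n : k ≤ n
  k≤n = below-witness (Fin.toℕ<n i) (closed-whole H)
  reachable⇔below : (v : Fin n) → Reachable H i v ⇔ toℕ v < k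
  reachable⇔below v = mk⇔ (λ i⇝v → closed-trap H holds i⇝v above)
                          (reach-below H loopless diam sorted i k least v)
  minimal : (m : ℕ) → suc (toℕ i) ≤ m → m < k → ¬ BalanceEq H m
  minimal m i<m m<k balanced = least m i<m m<k (balanced⇒closed H (ℕ.≤-trans (ℕ.<⇒≤ m<k) k≤n) balanced)
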